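{- Let $p$ be a prime, $d$ a positive integer with $p\nmid d$, and $0\le j\le p-1$. Then $L_j(\{d\})=L_{p-j}(\{d\})$.
   Context: For an integer $0\le j\le p$ and a positive integer $d$ with $p\nmid d$, $$L_j(\{d\})=\sum_{i=j}^{p-1}\left(\left\lfloor\frac{id}{p}\right\rfloor-\left\lfloor \frac{id}{p}-\left(1-\frac1p\right)\frac{jd}{p}\right\rfloor\right),$$ where for $j=p$ the sum is empty, so $L_p(\{d\})=0$. -}

module Defs where

open import Data.Nat using (ℕ; _*_; _+_; _∸_; NonZero)
open import Data.Integer using (ℤ; +_)
import Data.Integer as ℤ
open import Data.List using (List; map; upTo; foldr)
open import Data.Rational using (ℚ; _/_; floor; 1ℚ; _-_)
import Data.Rational as ℚ

-- The list of integers i with j ≤ i ≤ p - 1 (empty when j ≥ p).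
range : ℕ → ℕ → List ℕ
range j p = map (λ k → j + k) (upTo (p ∸ j))

summand : (p : ℕ) → .{{_ : NonZero p}} → (d j i : ℕ) → ℤ
summand p d j i =
  floor ((+ (i * d)) / p)
  ℤ.- floor (((+ (i * d)) / p) - ((1ℚ - ((+ 1) / p)) ℚ.* ((+ (j * d)) / p)))

L : (p d j : ℕ) → .{{_ : NonZero p}} → ℤ
L p d j = foldr ℤ._+_ (+ 0) (map (λ i → summand p d j i) (range j p))

module Submission where

-- Lemma (L_j({d}) = L_{p-j}({d})).  Write p = p' + 1, M = (p - 1) d and
-- width j = j d - ⌊j d / p⌋ = ⌈(p - 1) j d / p⌉.
--
-- The i-th summand ⌊x⌋ - ⌊x - y⌋ (x = i d / p, y = (p - 1) j d / p²) counts the n with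
-- x - y < n ≤ x; substituting s = i d - n p it equals #{ s < width j ∣ s ≡ i d (mod p) }.
-- So L_j counts the pairs (i, s) with j ≤ i < p, s < width j, s ≡ i d (mod p).
-- As i ↦ i d permutes the residues mod p (p prime, p ∤ d), adding the pairs with i < j
-- gives one pair per s < width j, i.e. width j pairs.  For m = p - j the reflection
-- (i, s) ↦ (p - 1 - i, M - s) maps the pairs counted by L_m onto the pairs with i < j,
-- width j ≤ s ≤ M (as width j + width m = M + 1); adding the same pairs with i < j,
-- s < width j yields all pairs with i < j, s ≤ M, whose number is width j by induction
-- on j.  Cancelling gives L_j = L_m.

open import Defs
open import Data.Nat using (ℕ; zero; suc; NonZero; _+_; _*_; _∸_; _≤_; _<_; _≟_; z≤n; s≤s)
open import Data.Nat.Properties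
open import Data.Nat.DivMod
open import Data.Nat.Divisibility using (_∣_; m%n≡0⇒n∣m; ∣⇒≤)
open import Data.Nat.Primality using (Prime; euclidsLemma)
open import Data.Nat.Tactic.RingSolver using (solve-∀)
open import Data.Integer as ℤ using (ℤ; +_)
import Data.Integer.Properties as ℤP
import Data.Integer.DivMod as ℤD
import Data.Integer.Tactic.RingSolver as ℤ-Ring
open import Data.Rational as ℚ using (ℚ; mkℚ; toℚᵘ; 1ℚ)
open import Data.Rational.Properties using (toℚᵘ-homo-+; toℚᵘ-homo-*; toℚᵘ-homo‿-; toℚᵘ-fromℚᵘ)
open import Data.Rational.Unnormalised as ℚᵘ using (mkℚᵘ; _≃_; *≡*)
import Data.Rational.Unnormalised.Properties as ℚᵘP
open import Data.List using (map; foldr; applyUpTo)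
open import Data.Product using (_×_; _,_; proj₁; proj₂)
open import Data.Sum using (inj₁; inj₂)
open import Data.Empty using (⊥-elim)
open import Relation.Nullary using (Dec; yes; no; ¬_)
open import Relation.Binary using (tri<; tri≈; tri>)
open import Relation.Binary.PropositionalEquality

∑ : ℕ → (ℕ → ℕ) → ℕ
∑ zero    f = 0
∑ (suc n) f = ∑ n f + f n

∑-cong : ∀ n {f g : ℕ → ℕ} → (∀ k → k < n → f k ≡ g k) → ∑ n f ≡ ∑ n g
∑-cong zero    f≗g = refl
∑-cong (suc n) f≗g = cong₂ _+_ (∑-cong n (λ k k<n → f≗g k (m<n⇒m<1+n k<n))) (f≗g n ≤-refl)

∑-zero : ∀ n {f : ℕ → ℕ} → (∀ k → k < n → f k ≡ 0) → ∑ n f ≡ 0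
∑-zero zero    f≗0 = refl
∑-zero (suc n) f≗0 = cong₂ _+_ (∑-zero n (λ k k<n → f≗0 k (m<n⇒m<1+n k<n))) (f≗0 n ≤-refl)

∑-ones : ∀ n → ∑ n (λ _ → 1) ≡ n
∑-ones zero    = refl
∑-ones (suc n) = trans (cong (_+ 1) (∑-ones n)) (+-comm n 1)

∑-head : ∀ n f → ∑ (suc n) f ≡ f 0 + ∑ n (λ k → f (suc k))
∑-head zero    f = sym (+-identityʳ (f 0))
∑-head (suc n) f = trans (cong (_+ f (suc n)) (∑-head n f)) (+-assoc (f 0) _ _)

∑-split : ∀ m n f → ∑ (m + n) f ≡ ∑ m f + ∑ n (λ k → f (m + k))
∑-split m zero    f = trans (cong (λ t → ∑ t f) (+-identityʳ m)) (sym (+-identityʳ _))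
∑-split m (suc n) f = begin
  ∑ (m + suc n) f                            ≡⟨ cong (λ t → ∑ t f) (+-suc m n) ⟩
  ∑ (m + n) f + f (m + n)                    ≡⟨ cong (_+ f (m + n)) (∑-split m n f) ⟩
  ∑ m f + ∑ n (λ k → f (m + k)) + f (m + n)  ≡⟨ +-assoc (∑ m f) _ _ ⟩
  ∑ m f + ∑ (suc n) (λ k → f (m + k))        ∎
  where open ≡-Reasoning

∑-+ : ∀ n f g → ∑ n (λ k → f k + g k) ≡ ∑ n f + ∑ n g
∑-+ zero    f g = refl
∑-+ (suc n) f g = trans (cong (_+ (f n + g n)) (∑-+ n f g)) (interchange (∑ n f) (∑ n g) (f n) (g n))
  where
  interchange : ∀ a b c d → a + b + (c + d) ≡ a + c + (b + d)
  interchange = solve-∀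

∑-swap : ∀ m n (f : ℕ → ℕ → ℕ) → ∑ m (λ i → ∑ n (f i)) ≡ ∑ n (λ s → ∑ m (λ i → f i s))
∑-swap zero    n f = sym (∑-zero n (λ _ _ → refl))
∑-swap (suc m) n f =
  trans (cong (_+ ∑ n (f m)) (∑-swap m n f)) (sym (∑-+ n (λ s → ∑ m (λ i → f i s)) (f m)))

-- Reindexing by the reversal a ↦ n - 1 - a, phrased without truncated subtraction.
∑-reverse : ∀ n (f g : ℕ → ℕ) → (∀ a b → a + b + 1 ≡ n → f a ≡ g b) → ∑ n f ≡ ∑ n g
∑-reverse zero    f g f≗g = refl
∑-reverse (suc n) f g f≗g = begin
  ∑ n f + f n                      ≡⟨ cong₂ _+_ (∑-reverse n f (λ k → g (suc k)) shifted) (f≗g n 0 n+0+1≡1+n) ⟩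
  ∑ n (λ k → g (suc k)) + g 0      ≡⟨ +-comm _ (g 0) ⟩
  g 0 + ∑ n (λ k → g (suc k))      ≡⟨ sym (∑-head n g) ⟩
  ∑ (suc n) g                      ∎
  where
  open ≡-Reasoning
  shifted : ∀ a b → a + b + 1 ≡ n → f a ≡ g (suc b)
  shifted a b eq = f≗g a (suc b) (trans (cong (_+ 1) (+-suc a b)) (cong suc eq))
  n+0+1≡1+n : n + 0 + 1 ≡ suc n
  n+0+1≡1+n = trans (cong (_+ 1) (+-identityʳ n)) (+-comm n 1)

reversed-index : ∀ a b c n q → a + b + 1 ≡ n → c + n ≡ suc q → a + (c + b) ≡ q
reversed-index a b c n q a+b+1≡n c+n≡1+q =
  suc-injective (trans (shift a b c) (trans (cong (λ x → c + x) a+b+1≡n) c+n≡1+q))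
  where
  shift : ∀ a b c → suc (a + (c + b)) ≡ c + (a + b + 1)
  shift = solve-∀

difference : ∀ x y z → x + y ≡ z → x ≡ z ∸ y
difference x y z x+y≡z = sym (trans (cong (_∸ y) (sym x+y≡z)) (m+n∸n≡m x y))

∑-≤-length : ∀ n f → (∀ k → k < n → f k ≤ 1) → ∑ n f ≤ n
∑-≤-length zero    f f≤1 = z≤n
∑-≤-length (suc n) f f≤1 =
  ≤-trans (+-mono-≤ (∑-≤-length n f (λ k k<n → f≤1 k (m<n⇒m<1+n k<n))) (f≤1 n ≤-refl))
          (≤-reflexive (+-comm n 1))

∑-≡-length : ∀ n f → (∀ k → k < n → f k ≤ 1) → ∑ n f ≡ n → ∀ k → k < n → f k ≡ 1
∑-≡-length (suc n) f f≤1 sum≡ k k<1+n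
  with full (∑-≤-length n f initial≤1) (f≤1 n ≤-refl) sum≡ | m≤n⇒m<n∨m≡n (≤-pred k<1+n)
  where
  initial≤1 : ∀ k → k < n → f k ≤ 1
  initial≤1 k k<n = f≤1 k (m<n⇒m<1+n k<n)
  full : ∀ {a b n} → a ≤ n → b ≤ 1 → a + b ≡ suc n → a ≡ n × b ≡ 1
  full {a} {zero}  a≤n _ a+0≡1+n = ⊥-elim (<-irrefl refl (≤-trans (≤-reflexive (trans (sym a+0≡1+n) (+-identityʳ a))) a≤n))
  full {a} {suc zero} {n} _ _ a+1≡1+n = +-cancelʳ-≡ 1 a n (trans a+1≡1+n (+-comm 1 n)) , refl
  full {b = suc (suc _)} _ (s≤s ()) _
... | initial≡n , _ | inj₁ k<n = ∑-≡-length n f (λ k k<n → f≤1 k (m<n⇒m<1+n k<n)) initial≡n k k<n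
... | _ , last≡1 | inj₂ refl = last≡1

𝟙 : {A : Set} → Dec A → ℕ
𝟙 (yes _) = 1
𝟙 (no _)  = 0

𝟙-false : {A : Set} (x : Dec A) → ¬ A → 𝟙 x ≡ 0
𝟙-false (yes a) ¬a = ⊥-elim (¬a a)
𝟙-false (no _)  _  = refl

𝟙-cong : {A B : Set} (x : Dec A) (y : Dec B) → (A → B) → (B → A) → 𝟙 x ≡ 𝟙 y
𝟙-cong (yes _) (yes _) _   _   = refl
𝟙-cong (yes a) (no ¬b) A⇒B _   = ⊥-elim (¬b (A⇒B a))
𝟙-cong (no ¬a) (yes b) _   B⇒A = ⊥-elim (¬a (B⇒A b))
𝟙-cong (no _)  (no _)  _   _   = refl

∑-𝟙-atMostOne : ∀ n {P : ℕ → Set} (P? : ∀ k → Dec (P k)) →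
                (∀ a b → a < n → b < n → P a → P b → a ≡ b) → ∑ n (λ k → 𝟙 (P? k)) ≤ 1
∑-𝟙-atMostOne zero    P? unique = z≤n
∑-𝟙-atMostOne (suc n) P? unique with P? n
... | no _   = ≤-trans (≤-reflexive (+-identityʳ _))
                       (∑-𝟙-atMostOne n P? (λ a b a<n b<n → unique a b (m<n⇒m<1+n a<n) (m<n⇒m<1+n b<n)))
... | yes Pn = ≤-reflexive (cong (_+ 1) (∑-zero n (λ k k<n → 𝟙-false (P? k)
                 (λ Pk → <-irrefl (unique k n (m<n⇒m<1+n k<n) ≤-refl Pk Pn) k<n))))

-- Congruences and counting of residues modulo p = p' + 1.
module Residues (p' : ℕ) where

  p : ℕ
  p = suc p'

  smaller-quotient : ∀ X Y a b → X + a * p ≡ Y + b * p → a < b → Y + p ≤ X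
  smaller-quotient X Y a b eq a<b = +-cancelʳ-≤ (a * p) (Y + p) X (begin
    Y + p + a * p   ≡⟨ +-assoc Y p (a * p) ⟩
    Y + suc a * p   ≤⟨ +-monoʳ-≤ Y (*-monoˡ-≤ p a<b) ⟩
    Y + b * p       ≡⟨ sym eq ⟩
    X + a * p       ∎)
    where open ≤-Reasoning

  quotient-unique : ∀ X Y a b → X + a * p ≡ Y + b * p → X < Y + p → Y < X + p → a ≡ b
  quotient-unique X Y a b eq X<Y+p Y<X+p with <-cmp a b
  ... | tri< a<b _ _ = ⊥-elim (<⇒≱ X<Y+p (smaller-quotient X Y a b eq a<b))
  ... | tri≈ _ a≡b _ = a≡b
  ... | tri> _ _ b<a = ⊥-elim (<⇒≱ Y<X+p (smaller-quotient Y X b a (sym eq) b<a))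

  ≡-mod-intro : ∀ x y a b → x + a * p ≡ y + b * p → x % p ≡ y % p
  ≡-mod-intro x y a b eq = trans (sym ([m+kn]%n≡m%n x a p)) (trans (cong (_% p) eq) ([m+kn]%n≡m%n y b p))

  ≡-mod-elim : ∀ x y → x % p ≡ y % p → x + (y / p) * p ≡ y + (x / p) * p
  ≡-mod-elim x y eq = begin
    x + (y / p) * p                    ≡⟨ cong (_+ (y / p) * p) (m≡m%n+[m/n]*n x p) ⟩
    x % p + (x / p) * p + (y / p) * p  ≡⟨ swap (x % p) ((x / p) * p) ((y / p) * p) ⟩
    x % p + (y / p) * p + (x / p) * p  ≡⟨ cong (λ r → r + (y / p) * p + (x / p) * p) eq ⟩
    y % p + (y / p) * p + (x / p) * p  ≡⟨ cong (_+ (x / p) * p) (sym (m≡m%n+[m/n]*n y p)) ⟩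
    y + (x / p) * p                    ∎
    where
    open ≡-Reasoning
    swap : ∀ a b c → a + b + c ≡ a + c + b
    swap = solve-∀

  ≡-mod-window : ∀ x y → x ≤ y → y < x + p → x % p ≡ y % p → x ≡ y
  ≡-mod-window x y x≤y y<x+p eq = +-cancelʳ-≡ ((y / p) * p) x y (trans shifted (cong (λ q → y + q * p) (sym same-quotient)))
    where
    shifted : x + (y / p) * p ≡ y + (x / p) * p
    shifted = ≡-mod-elim x y eq
    same-quotient : y / p ≡ x / p
    same-quotient = quotient-unique x y (y / p) (x / p) shifted (≤-<-trans x≤y (m<m+n y {p} (s≤s z≤n))) y<x+p

  ≡-mod-cancel : ∀ u v x y → (u + x) % p ≡ (v + y) % p → x % p ≡ y % p → u % p ≡ v % p
  ≡-mod-cancel u v x y u+x≡v+y x≡y = ≡-mod-intro u v (A + D) (B + C) (+-cancelʳ-≡ (x + y) _ _ (begin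
    u + (A + D) * p + (x + y)             ≡⟨ regroup₁ u x y A D p ⟩
    (u + x + A * p) + (y + D * p)         ≡⟨ cong₂ _+_ (≡-mod-elim (u + x) (v + y) u+x≡v+y) (sym (≡-mod-elim x y x≡y)) ⟩
    (v + y + B * p) + (x + C * p)         ≡⟨ regroup₂ v x y B C p ⟩
    v + (B + C) * p + (x + y)             ∎))
    where
    open ≡-Reasoning
    A B C D : ℕ
    A = (v + y) / p
    B = (u + x) / p
    C = y / p
    D = x / p
    regroup₁ : ∀ u x y A D p → u + (A + D) * p + (x + y) ≡ (u + x + A * p) + (y + D * p)
    regroup₁ = solve-∀
    regroup₂ : ∀ v x y B C p → (v + y + B * p) + (x + C * p) ≡ v + (B + C) * p + (x + y)
    regroup₂ = solve-∀

  residue-of : ∀ R c → R < p → (R + c * p) % p ≡ R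
  residue-of R c R<p = trans ([m+kn]%n≡m%n R c p) (m<n⇒m%n≡m R<p)

  count : ℕ → ℕ → ℕ
  count N R = ∑ N (λ s → 𝟙 (s % p ≟ R))

  -- The first number ≡ R (mod p) not counted by count N R lies in [N, N + p).
  count-window : ∀ N R → R < p → N ≤ R + count N R * p × R + count N R * p < N + p
  count-window zero    R R<p = z≤n , ≤-trans (≤-reflexive (cong suc (+-identityʳ R))) R<p
  count-window (suc N) R R<p with count-window N R R<p | N % p ≟ R
  ... | N≤next , next<N+p | yes N≡R = subst (λ t → suc N ≤ t × t < suc N + p) (sym next′≡N+p) (1+N≤N+p , ≤-refl)
    where
    next≡N : N ≡ R + count N R * p
    next≡N = ≡-mod-window N _ N≤next next<N+p (trans N≡R (sym (residue-of R (count N R) R<p)))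
    next′≡N+p : R + (count N R + 1) * p ≡ N + p
    next′≡N+p = trans (step R (count N R) p) (cong (_+ p) (sym next≡N))
      where
      step : ∀ R c p → R + (c + 1) * p ≡ R + c * p + p
      step = solve-∀
    1+N≤N+p : suc N ≤ N + p
    1+N≤N+p = ≤-trans (s≤s (m≤m+n N p')) (≤-reflexive (sym (+-suc N p')))
  ... | N≤next , next<N+p | no N≢R =
    subst (λ c → suc N ≤ R + c * p × R + c * p < suc N + p) (sym (+-identityʳ (count N R)))
          (≤∧≢⇒< N≤next (λ N≡next → N≢R (trans (cong (_% p) N≡next) (residue-of R (count N R) R<p))) ,
           m<n⇒m<1+n next<N+p)

  count-period : ∀ R → R < p → count p R ≡ 1
  count-period R R<p with count p R | count-window p R R<p
  ... | zero        | p≤R+0 , _      = ⊥-elim (<⇒≱ R<p (≤-trans p≤R+0 (≤-reflexive (+-identityʳ R))))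
  ... | suc zero    | _              = refl
  ... | suc (suc c) | _ , R+[2+c]p<2p = ⊥-elim (<⇒≱ R+[2+c]p<2p (≤-trans (+-monoʳ-≤ p (m≤m+n p (c * p))) (m≤n+m _ R)))

  ≡-mod-reflect : ∀ n x y → x ≤ n → y ≤ n → x % p ≡ y % p → (n ∸ x) % p ≡ (n ∸ y) % p
  ≡-mod-reflect n x y x≤n y≤n =
    ≡-mod-cancel (n ∸ x) (n ∸ y) x y (cong (_% p) (trans (m∸n+n≡m x≤n) (sym (m∸n+n≡m y≤n))))

  ≡-mod-reflect⁻¹ : ∀ n x y → x ≤ n → y ≤ n → (n ∸ x) % p ≡ (n ∸ y) % p → x % p ≡ y % p
  ≡-mod-reflect⁻¹ n x y x≤n y≤n =
    ≡-mod-cancel x y (n ∸ x) (n ∸ y) (cong (_% p) (trans (m+[n∸m]≡n x≤n) (sym (m+[n∸m]≡n y≤n))))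

  multiple-below-2p : ∀ S → S % p ≡ 0 → 0 < S → S < p + p → S ≡ p
  multiple-below-2p S S≡0 0<S S<2p with ≤-total p S
  ... | inj₁ p≤S = sym (≡-mod-window p S p≤S S<2p (trans (n%n≡0 p) (sym S≡0)))
  ... | inj₂ S≤p with m≤n⇒m<n∨m≡n S≤p
  ...   | inj₁ S<p = ⊥-elim (<⇒≢ 0<S (sym (trans (sym (m<n⇒m%n≡m S<p)) S≡0)))
  ...   | inj₂ S≡p = S≡p

-- Residues of multiples i d modulo p = p' + 1; here M = (p - 1) d.
module Dilation (p' d : ℕ) where

  open Residues p'

  hit : ℕ → ℕ → ℕ
  hit i s = 𝟙 (s % p ≟ (i * d) % p)

  M : ℕ
  M = p' * d

  -- width k = k d - ⌊k d / p⌋ = ⌈(p - 1) k d / p⌉, the number of integers in [0, (p - 1) k d / p).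
  width : ℕ → ℕ
  width k = k * d ∸ (k * d) / p

  width-scaled : ∀ k → width k * p ≡ p' * (k * d) + (k * d) % p
  width-scaled k = begin
    width k * p              ≡⟨ cong (_* p) width≡ ⟩
    (r + q * p') * p         ≡⟨ expand r q p' ⟩
    p' * (r + q * p) + r     ≡⟨ cong (λ n → p' * n + r) (sym kd≡) ⟩
    p' * (k * d) + r         ∎
    where
    open ≡-Reasoning
    q r : ℕ
    q = (k * d) / p
    r = (k * d) % p
    kd≡ : k * d ≡ r + q * p
    kd≡ = m≡m%n+[m/n]*n (k * d) p
    split : ∀ r q p' → r + q * suc p' ≡ (r + q * p') + q
    split = solve-∀
    expand : ∀ r q p' → (r + q * p') * suc p' ≡ p' * (r + q * suc p') + r
    expand = solve-∀
    width≡ : width k ≡ r + q * p'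
    width≡ = +-cancelʳ-≡ q _ _ (trans (m∸n+n≡m (m/n≤m (k * d) p)) (trans kd≡ (split r q p')))

  hit-reflect : ∀ k t → k ≤ p' → t ≤ M → hit (p' ∸ k) (M ∸ t) ≡ hit k t
  hit-reflect k t k≤p' t≤M = 𝟙-cong _ _
    (λ M-t≡M-kd → ≡-mod-reflect⁻¹ M t (k * d) t≤M kd≤M (trans M-t≡M-kd (cong (_% p) [p'-k]d≡M-kd)))
    (λ t≡kd → trans (≡-mod-reflect M t (k * d) t≤M kd≤M t≡kd) (cong (_% p) (sym [p'-k]d≡M-kd)))
    where
    kd≤M : k * d ≤ M
    kd≤M = *-monoˡ-≤ d k≤p'
    [p'-k]d≡M-kd : (p' ∸ k) * d ≡ M ∸ k * d
    [p'-k]d≡M-kd = *-distribʳ-∸ d p' k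

  -- For prime p ∤ d, multiplication by d permutes the residues modulo p.
  module Coprime (p-prime : Prime p) (p∤d : ¬ p ∣ d) where

    residue-nonzero : ∀ t → 0 < t → t < p → (t * d) % p ≢ 0
    residue-nonzero t@(suc _) _ t<p td≡0 with euclidsLemma t d p-prime (m%n≡0⇒n∣m (t * d) p td≡0)
    ... | inj₁ p∣t = <⇒≱ t<p (∣⇒≤ p∣t)
    ... | inj₂ p∣d = p∤d p∣d

    no-gap : ∀ i t → i + t < p → (i * d) % p ≡ ((i + t) * d) % p → t ≡ 0
    no-gap i zero    _     _  = refl
    no-gap i (suc t) i+t<p eq = ⊥-elim (residue-nonzero (suc t) (s≤s z≤n) (≤-<-trans (m≤n+m (suc t) i) i+t<p)
      (≡-mod-cancel (suc t * d) 0 (i * d) (i * d) (trans (cong (_% p) (distrib (suc t) i d)) (sym eq)) refl))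
      where
      distrib : ∀ t i d → t * d + i * d ≡ (i + t) * d
      distrib = solve-∀

    dilation-injective : ∀ i i′ → i < p → i′ < p → (i * d) % p ≡ (i′ * d) % p → i ≡ i′
    dilation-injective i i′ i<p i′<p eq with ≤-total i i′
    ... | inj₁ i≤i′ with m≤n⇒∃[o]m+o≡n i≤i′
    ...   | t , refl = sym (trans (cong (λ n → i + n) (no-gap i t i′<p eq)) (+-identityʳ i))
    dilation-injective i i′ i<p i′<p eq | inj₂ i′≤i with m≤n⇒∃[o]m+o≡n i′≤i
    ...   | t , refl = trans (cong (λ n → i′ + n) (no-gap i′ t i<p (sym eq))) (+-identityʳ i′)

    hits-once : ∀ s → ∑ p (λ i → hit i s) ≡ 1
    hits-once s = trans (∑-cong p (λ i _ → 𝟙-cong _ _ (trans (m%n%n≡m%n s p)) (trans (sym (m%n%n≡m%n s p)))))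
                        (∑-≡-length p (λ s → ∑ p (λ i → hit i s)) (λ s _ → at-most-once s) total (s % p) (m%n<n s p))
      where
      at-most-once : ∀ s → ∑ p (λ i → hit i s) ≤ 1
      at-most-once s = ∑-𝟙-atMostOne p (λ i → s % p ≟ (i * d) % p)
                         (λ a b a<p b<p sa sb → dilation-injective a b a<p b<p (trans (sym sa) sb))
      total : ∑ p (λ s → ∑ p (λ i → hit i s)) ≡ p
      total = begin
        ∑ p (λ s → ∑ p (λ i → hit i s))   ≡⟨ sym (∑-swap p p hit) ⟩
        ∑ p (λ i → count p ((i * d) % p))  ≡⟨ ∑-cong p (λ i _ → count-period ((i * d) % p) (m%n<n (i * d) p)) ⟩
        ∑ p (λ _ → 1)                      ≡⟨ ∑-ones p ⟩
        p                                  ∎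
        where open ≡-Reasoning

    complementary-residues : ∀ j m → j + m ≡ p → 0 < j → 0 < m → (j * d) % p + (m * d) % p ≡ p
    complementary-residues j m j+m≡p 0<j 0<m = multiple-below-2p _ S≡0 0<S (+-mono-< (m%n<n (j * d) p) (m%n<n (m * d) p))
      where
      j<p : j < p
      j<p = <-≤-trans (m<m+n j 0<m) (≤-reflexive j+m≡p)
      0<S : 0 < (j * d) % p + (m * d) % p
      0<S = <-≤-trans (n≢0⇒n>0 (residue-nonzero j 0<j j<p)) (m≤m+n _ _)
      factor : ∀ j m d → j * d + m * d ≡ d * (j + m)
      factor = solve-∀
      S≡0 : ((j * d) % p + (m * d) % p) % p ≡ 0
      S≡0 = begin
        ((j * d) % p + (m * d) % p) % p  ≡⟨ sym (%-distribˡ-+ (j * d) (m * d) p) ⟩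
        (j * d + m * d) % p              ≡⟨ cong (_% p) (trans (factor j m d) (cong (d *_) j+m≡p)) ⟩
        (d * p) % p                      ≡⟨ m*n%n≡0 d p ⟩
        0                                ∎
        where open ≡-Reasoning

    width-complement : ∀ j m → j + m ≡ p → 0 < j → 0 < m → width j + width m ≡ suc M
    width-complement j m j+m≡p 0<j 0<m = *-cancelʳ-≡ _ _ p (begin
      (width j + width m) * p                                     ≡⟨ *-distribʳ-+ p (width j) (width m) ⟩
      width j * p + width m * p                                   ≡⟨ cong₂ _+_ (width-scaled j) (width-scaled m) ⟩
      p' * (j * d) + Rj + (p' * (m * d) + Rm)                     ≡⟨ regroup p' j m d Rj Rm ⟩
      p' * ((j + m) * d) + (Rj + Rm)                              ≡⟨ cong₂ (λ n R → p' * (n * d) + R) j+m≡p (complementary-residues j m j+m≡p 0<j 0<m) ⟩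
      p' * (p * d) + p                                            ≡⟨ collect p' d ⟩
      suc M * p                                                   ∎)
      where
      open ≡-Reasoning
      Rj Rm : ℕ
      Rj = (j * d) % p
      Rm = (m * d) % p
      regroup : ∀ p' j m d Rj Rm → p' * (j * d) + Rj + (p' * (m * d) + Rm) ≡ p' * ((j + m) * d) + (Rj + Rm)
      regroup = solve-∀
      collect : ∀ p' d → p' * (suc p' * d) + suc p' ≡ suc (p' * d) * suc p'
      collect = solve-∀

    width-step : ∀ j → suc j < p → width (suc j) ≡ width j + count (suc M) ((j * d) % p)
    width-step j 1+j<p = quotient-unique X Y (width (suc j)) (width j + c) identity X<Y+p Y<X+p
      where
      open ≡-Reasoning
      R₀ R₁ c X Y : ℕ
      R₀ = (j * d) % p
      R₁ = (suc j * d) % p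
      c  = count (suc M) R₀
      X = R₀ + c * p
      Y = M + R₁
      window : suc M ≤ X × X < suc M + p
      window = count-window (suc M) R₀ (m%n<n (j * d) p)
      regroup : ∀ R₀ c p' j d R₁ → R₀ + c * suc p' + (p' * (d + j * d) + R₁) ≡ p' * d + R₁ + (p' * (j * d) + R₀ + c * suc p')
      regroup = solve-∀
      identity : X + width (suc j) * p ≡ Y + (width j + c) * p
      identity = begin
        X + width (suc j) * p                     ≡⟨ cong (λ n → X + n) (width-scaled (suc j)) ⟩
        R₀ + c * p + (p' * (d + j * d) + R₁)      ≡⟨ regroup R₀ c p' j d R₁ ⟩
        Y + (p' * (j * d) + R₀ + c * p)           ≡⟨ cong (λ n → Y + (n + c * p)) (sym (width-scaled j)) ⟩
        Y + (width j * p + c * p)                 ≡⟨ cong (λ n → Y + n) (sym (*-distribʳ-+ p (width j) c)) ⟩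
        Y + (width j + c) * p                     ∎
      1+M≤Y : suc M ≤ Y
      1+M≤Y = ≤-trans (≤-reflexive (+-comm 1 M)) (+-monoʳ-≤ M (n≢0⇒n>0 (residue-nonzero (suc j) (s≤s z≤n) 1+j<p)))
      X<Y+p : X < Y + p
      X<Y+p = <-≤-trans (proj₂ window) (+-monoˡ-≤ p 1+M≤Y)
      Y<X+p : Y < X + p
      Y<X+p = <-trans (+-monoʳ-< M (m%n<n (suc j * d) p)) (+-monoˡ-< p (proj₁ window))

    width-as-count : ∀ j → j < p → ∑ j (λ i → ∑ (suc M) (hit i)) ≡ width j
    width-as-count zero    _     = refl
    width-as-count (suc j) 1+j<p =
      trans (cong (_+ count (suc M) ((j * d) % p)) (width-as-count j (<-trans (n<1+n j) 1+j<p))) (sym (width-step j 1+j<p))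

    -- Double counting: for j + m = p, the pairs (i, s) with j ≤ i < p, s < width j and
    -- the pairs with m ≤ i < p, s < width m (both with s ≡ i d) are equinumerous, since
    -- adding the pairs with i < j, s < width j completes either set to width j.
    pairs-complement : ∀ j m → j + m ≡ p → 0 < j → 0 < m →
                       ∑ m (λ k → ∑ (width j) (hit (j + k))) ≡ ∑ j (λ k → ∑ (width m) (hit (m + k)))
    pairs-complement j m j+m≡p 0<j 0<m = +-cancelʳ-≡ Z _ _ (trans upper-completed (sym lower-completed))
      where
      open ≡-Reasoning
      N N′ Z : ℕ
      N  = width j
      N′ = width m
      Z  = ∑ j (λ i → ∑ N (hit i))

      -- The pairs with i < p and s < N are exactly one per s.
      upper-completed : ∑ m (λ k → ∑ N (hit (j + k))) + Z ≡ N
      upper-completed = begin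
        ∑ m (λ k → ∑ N (hit (j + k))) + Z   ≡⟨ +-comm _ Z ⟩
        Z + ∑ m (λ k → ∑ N (hit (j + k)))   ≡⟨ sym (∑-split j m (λ i → ∑ N (hit i))) ⟩
        ∑ (j + m) (λ i → ∑ N (hit i))       ≡⟨ cong (λ n → ∑ n (λ i → ∑ N (hit i))) j+m≡p ⟩
        ∑ p (λ i → ∑ N (hit i))             ≡⟨ ∑-swap p N hit ⟩
        ∑ N (λ s → ∑ p (λ i → hit i s))     ≡⟨ ∑-cong N (λ s _ → hits-once s) ⟩
        ∑ N (λ _ → 1)                       ≡⟨ ∑-ones N ⟩
        N                                   ∎

      -- Reflecting (i, s) ↦ (p - 1 - i, M - s) turns the pairs with m ≤ i < p, s < N′
      -- into the pairs with i < j, N ≤ s ≤ M.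
      reflected : ∀ k → k < j → ∑ N′ (hit (p' ∸ k)) ≡ ∑ N′ (λ s → hit k (N + s))
      reflected k k<j = ∑-reverse N′ (hit (p' ∸ k)) (λ s → hit k (N + s)) (λ a b a+b+1≡N′ →
        let a+[N+b]≡M = reversed-index a b N N′ M a+b+1≡N′ (width-complement j m j+m≡p 0<j 0<m)
        in trans (cong (hit (p' ∸ k)) (difference a (N + b) M a+[N+b]≡M))
                 (hit-reflect k (N + b) k≤p' (≤-trans (m≤n+m (N + b) a) (≤-reflexive a+[N+b]≡M))))
        where
        k≤p' : k ≤ p'
        k≤p' = ≤-pred (<-≤-trans k<j (≤-trans (m≤m+n j m) (≤-reflexive j+m≡p)))

      lower-reflected : ∑ j (λ k → ∑ N′ (hit (m + k))) ≡ ∑ j (λ k → ∑ N′ (λ s → hit k (N + s)))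
      lower-reflected = begin
        ∑ j (λ k → ∑ N′ (hit (m + k)))          ≡⟨ sym (∑-reverse j (λ k → ∑ N′ (hit (p' ∸ k))) (λ k → ∑ N′ (hit (m + k)))
                                                         (λ a b a+b+1≡j → cong (λ i → ∑ N′ (hit i)) (sym (mirror a b a+b+1≡j)))) ⟩
        ∑ j (λ k → ∑ N′ (hit (p' ∸ k)))         ≡⟨ ∑-cong j reflected ⟩
        ∑ j (λ k → ∑ N′ (λ s → hit k (N + s))) ∎
        where
        mirror : ∀ a b → a + b + 1 ≡ j → m + b ≡ p' ∸ a
        mirror a b a+b+1≡j = difference (m + b) a p'
          (trans (+-comm (m + b) a) (reversed-index a b m j p' a+b+1≡j (trans (+-comm m j) j+m≡p)))

      lower-completed : ∑ j (λ k → ∑ N′ (hit (m + k))) + Z ≡ N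
      lower-completed = begin
        ∑ j (λ k → ∑ N′ (hit (m + k))) + Z                        ≡⟨ cong (_+ Z) lower-reflected ⟩
        ∑ j (λ k → ∑ N′ (λ s → hit k (N + s))) + Z                ≡⟨ sym (∑-+ j _ _) ⟩
        ∑ j (λ k → ∑ N′ (λ s → hit k (N + s)) + ∑ N (hit k))      ≡⟨ ∑-cong j (λ k _ → trans (+-comm _ (∑ N (hit k))) (sym (∑-split N N′ (hit k)))) ⟩
        ∑ j (λ k → ∑ (N + N′) (hit k))                           ≡⟨ cong (λ n → ∑ j (λ k → ∑ n (hit k))) (width-complement j m j+m≡p 0<j 0<m) ⟩
        ∑ j (λ k → ∑ (suc M) (hit k))                            ≡⟨ width-as-count j (<-≤-trans (m<m+n j 0<m) (≤-reflexive j+m≡p)) ⟩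
        N                                                        ∎

    pairs : ℕ → ℕ
    pairs j = ∑ (p ∸ j) (λ k → ∑ (width j) (hit (j + k)))

    -- The lemma in counting form; for j = 0 both sides are empty sums.
    pairs-symmetric : ∀ j → j < p → pairs j ≡ pairs (p ∸ j)
    pairs-symmetric zero    _     = trans (∑-zero p (λ _ _ → refl)) (cong (λ n → ∑ n (λ k → ∑ (width p) (hit (p + k)))) (sym (n∸n≡0 p)))
    pairs-symmetric (suc j) 1+j<p = trans (pairs-complement (suc j) m (m+[n∸m]≡n (<⇒≤ 1+j<p)) (s≤s z≤n) (m<n⇒0<n∸m 1+j<p))
                                          (cong (λ n → ∑ n (λ k → ∑ (width m) (hit (m + k)))) (sym (m∸[m∸n]≡n (<⇒≤ 1+j<p))))
      where m = p ∸ suc j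

window-below : ∀ n k m (e : ℕ) → n ℤ.< k → m ℤ.< n ℤ.* + suc e ℤ.+ + suc e → ¬ (k ℤ.* + suc e ℤ.≤ m)
window-below n k m e n<k m<next ke≤m = ℤP.<-irrefl refl (ℤP.<-≤-trans m<next (begin
  n ℤ.* E ℤ.+ E       ≡⟨ sym (succ-times n E) ⟩
  (+ 1 ℤ.+ n) ℤ.* E   ≤⟨ ℤP.*-monoʳ-≤-nonNeg E (ℤP.i<j⇒suc[i]≤j n<k) ⟩
  k ℤ.* E             ≤⟨ ke≤m ⟩
  m                   ∎))
  where
  open ℤP.≤-Reasoning
  E : ℤ
  E = + suc e
  succ-times : ∀ n E → (+ 1 ℤ.+ n) ℤ.* E ≡ n ℤ.* E ℤ.+ E
  succ-times = ℤ-Ring.solve-∀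

div-upper : ∀ m (e : ℕ) → m ℤ.< (m ℤ./ + suc e) ℤ.* + suc e ℤ.+ + suc e
div-upper m e = begin-strict
  m                          ≡⟨ ℤD.a≡a%n+[a/n]*n m E ⟩
  + (m ℤ.% E) ℤ.+ q ℤ.* E    <⟨ ℤP.+-monoˡ-< (q ℤ.* E) (ℤ.+<+ (ℤD.n%d<d m E)) ⟩
  E ℤ.+ q ℤ.* E              ≡⟨ ℤP.+-comm E (q ℤ.* E) ⟩
  q ℤ.* E ℤ.+ E              ∎
  where
  open ℤP.≤-Reasoning
  E q : ℤ
  E = + suc e
  q = m ℤ./ E

div-unique : ∀ m n (e : ℕ) → n ℤ.* + suc e ℤ.≤ m → m ℤ.< n ℤ.* + suc e ℤ.+ + suc e → m ℤ./ + suc e ≡ n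
div-unique m n e ne≤m m<ne+e with ℤP.<-cmp (m ℤ./ + suc e) n
... | tri< q<n _ _ = ⊥-elim (window-below (m ℤ./ + suc e) n m e q<n (div-upper m e) ne≤m)
... | tri≈ _ q≡n _ = q≡n
... | tri> _ _ n<q = ⊥-elim (window-below n (m ℤ./ + suc e) m e n<q m<ne+e (ℤD.[n/d]*d≤n m (+ suc e)))

floor-by-bounds : (q : ℚ) (X : ℤ) (D-1 : ℕ) (n : ℤ) → toℚᵘ q ≃ mkℚᵘ X D-1 →
                  n ℤ.* + suc D-1 ℤ.≤ X → X ℤ.< n ℤ.* + suc D-1 ℤ.+ + suc D-1 → ℚ.floor q ≡ n
floor-by-bounds (mkℚ m e _) X D-1 n (*≡* mD≡XE) nD≤X X<nD+D = div-unique m n e nE≤m m<nE+E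
  where
  D E : ℤ
  D = + suc D-1
  E = + suc e
  reorder : ∀ n D E → n ℤ.* D ℤ.* E ≡ n ℤ.* E ℤ.* D
  reorder = ℤ-Ring.solve-∀
  reorder-next : ∀ n D E → (n ℤ.* D ℤ.+ D) ℤ.* E ≡ (n ℤ.* E ℤ.+ E) ℤ.* D
  reorder-next = ℤ-Ring.solve-∀
  nE≤m : n ℤ.* E ℤ.≤ m
  nE≤m = ℤP.*-cancelʳ-≤-pos (n ℤ.* E) m D (begin
    n ℤ.* E ℤ.* D   ≡⟨ sym (reorder n D E) ⟩
    n ℤ.* D ℤ.* E   ≤⟨ ℤP.*-monoʳ-≤-nonNeg E nD≤X ⟩
    X ℤ.* E         ≡⟨ sym mD≡XE ⟩
    m ℤ.* D         ∎)
    where open ℤP.≤-Reasoning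
  m<nE+E : m ℤ.< n ℤ.* E ℤ.+ E
  m<nE+E = ℤP.*-cancelʳ-<-nonNeg D (begin-strict
    m ℤ.* D                    ≡⟨ mD≡XE ⟩
    X ℤ.* E                    <⟨ ℤP.*-monoʳ-<-pos E X<nD+D ⟩
    (n ℤ.* D ℤ.+ D) ℤ.* E      ≡⟨ reorder-next n D E ⟩
    (n ℤ.* E ℤ.+ E) ℤ.* D      ∎)
    where open ℤP.≤-Reasoning

floor-by-remainder : (q : ℚ) (X : ℤ) (D-1 : ℕ) (n : ℤ) (r : ℕ) → toℚᵘ q ≃ mkℚᵘ X D-1 →
                     X ≡ n ℤ.* + suc D-1 ℤ.+ + r → r < suc D-1 → ℚ.floor q ≡ n
floor-by-remainder q X D-1 n r q≃X/D X≡nD+r r<D = floor-by-bounds q X D-1 n q≃X/D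
  (ℤP.≤-trans (ℤP.i≤i+j (n ℤ.* + suc D-1) (+ r)) (ℤP.≤-reflexive (sym X≡nD+r)))
  (ℤP.≤-<-trans (ℤP.≤-reflexive X≡nD+r) (ℤP.+-monoʳ-< (n ℤ.* + suc D-1) (ℤ.+<+ r<D)))

fraction : ∀ a n → toℚᵘ (+ a ℚ./ suc n) ≃ mkℚᵘ (+ a) n
fraction a n = toℚᵘ-fromℚᵘ (mkℚᵘ (+ a) n)

toℚᵘ-homo-− : ∀ x y → toℚᵘ (x ℚ.- y) ≃ toℚᵘ x ℚᵘ.- toℚᵘ y
toℚᵘ-homo-− x y = ℚᵘP.≃-trans (toℚᵘ-homo-+ x (ℚ.- y)) (ℚᵘP.+-congʳ (toℚᵘ x) (toℚᵘ-homo‿- y))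

floor-fraction : ∀ a n → ℚ.floor (+ a ℚ./ suc n) ≡ + (a / suc n)
floor-fraction a n = floor-by-remainder (+ a ℚ./ suc n) (+ a) n (+ q) r (fraction a n) (begin
  + a                          ≡⟨ cong +_ (trans (m≡m%n+[m/n]*n a (suc n)) (+-comm r (q * suc n))) ⟩
  + (q * suc n + r)            ≡⟨ ℤP.pos-+ (q * suc n) r ⟩
  + (q * suc n) ℤ.+ + r        ≡⟨ cong (ℤ._+ + r) (ℤP.pos-* q (suc n)) ⟩
  + q ℤ.* + suc n ℤ.+ + r      ∎) (m%n<n a (suc n))
  where
  open ≡-Reasoning
  q r : ℕ
  q = a / suc n
  r = a % suc n

-- The rational a / p - (1 - 1 / p) (b / p) occurring in the summand, for p = p' + 1,
-- and its representation with numerator a p - (p - 1) b over the denominator p².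
shifted : ℕ → ℕ → ℕ → ℚ
shifted p' a b = (+ a ℚ./ suc p') ℚ.- ((1ℚ ℚ.- (+ 1 ℚ./ suc p')) ℚ.* (+ b ℚ./ suc p'))

shifted-numerator : ℕ → ℕ → ℕ → ℤ
shifted-numerator p' a b = + a ℤ.* + suc p' ℤ.- (+ suc p' ℤ.- + 1) ℤ.* + b

shifted-representation : ∀ p' a b → toℚᵘ (shifted p' a b) ≃ mkℚᵘ (shifted-numerator p' a b) (p' + p' * suc p')
shifted-representation p' a b = ℚᵘP.≃-trans homomorphic (*≡* (arithmetic (+ a) (+ b) (+ suc p')))
  where
  1/p : ℚ
  1/p = + 1 ℚ./ suc p'
  homomorphic : toℚᵘ (shifted p' a b) ≃ mkℚᵘ (+ a) p' ℚᵘ.- ((ℚᵘ.1ℚᵘ ℚᵘ.- mkℚᵘ (+ 1) p') ℚᵘ.* mkℚᵘ (+ b) p')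
  homomorphic = ℚᵘP.≃-trans (toℚᵘ-homo-− (+ a ℚ./ suc p') ((1ℚ ℚ.- 1/p) ℚ.* (+ b ℚ./ suc p')))
    (ℚᵘP.+-cong (fraction a p') (ℚᵘP.-‿cong (ℚᵘP.≃-trans (toℚᵘ-homo-* (1ℚ ℚ.- 1/p) (+ b ℚ./ suc p'))
      (ℚᵘP.*-cong (ℚᵘP.≃-trans (toℚᵘ-homo-− 1ℚ 1/p) (ℚᵘP.+-congʳ (toℚᵘ 1ℚ) (ℚᵘP.-‿cong (fraction 1 p'))))
                  (fraction b p')))))
  -- Cross-multiplying the unnormalised difference (numerator and denominator as computed by ℚᵘ).
  arithmetic : ∀ A B P → (A ℤ.* ((+ 1 ℤ.* P) ℤ.* P) ℤ.+ (ℤ.- ((+ 1 ℤ.* P ℤ.+ (ℤ.- + 1) ℤ.* + 1) ℤ.* B)) ℤ.* P) ℤ.* (P ℤ.* P)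
                       ≡ (A ℤ.* P ℤ.- (P ℤ.- + 1) ℤ.* B) ℤ.* (P ℤ.* ((+ 1 ℤ.* P) ℤ.* P))
  arithmetic = ℤ-Ring.solve-∀

module Summand (p' d j i : ℕ) where
  open Residues p'
  open Dilation p' d

  a b q R c : ℕ
  a = i * d
  b = j * d
  q = a / p
  R = a % p
  c = count (width j) R

  U V : ℕ
  U = (R + c * p) * p
  V = p' * b

  -- The window property of c = count (width j) R, rescaled by p, places U within p² above V.
  V≤U : V ≤ U
  V≤U = begin
    V                    ≤⟨ m≤m+n V (b % p) ⟩
    V + b % p            ≡⟨ sym (width-scaled j) ⟩
    width j * p          ≤⟨ *-monoˡ-≤ p (proj₁ (count-window (width j) R (m%n<n a p))) ⟩
    U                    ∎
    where open ≤-Reasoning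

  U<V+p² : U < V + p * p
  U<V+p² = +-cancelʳ-< p U (V + p * p) (begin-strict
    U + p                ≡⟨ +-comm U p ⟩
    suc (R + c * p) * p  ≤⟨ *-monoˡ-≤ p (proj₂ (count-window (width j) R (m%n<n a p))) ⟩
    (width j + p) * p    ≡⟨ *-distribʳ-+ p (width j) p ⟩
    width j * p + p * p  ≡⟨ cong (_+ p * p) (width-scaled j) ⟩
    V + b % p + p * p    <⟨ +-monoˡ-< (p * p) (+-monoʳ-< V (m%n<n b p)) ⟩
    V + p + p * p        ≡⟨ swap V p (p * p) ⟩
    V + p * p + p        ∎)
    where
    open ≤-Reasoning
    swap : ∀ a b c → a + b + c ≡ a + c + b
    swap = solve-∀

  numerator-split : shifted-numerator p' a b ≡ (+ q ℤ.- + c) ℤ.* + (p * p) ℤ.+ + (U ∸ V)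
  numerator-split = begin
    + a ℤ.* + p ℤ.- (+ p ℤ.- + 1) ℤ.* + b
      ≡⟨ cong (λ x → x ℤ.* + p ℤ.- (+ p ℤ.- + 1) ℤ.* + b) a≡ ⟩
    (+ R ℤ.+ + q ℤ.* + p) ℤ.* + p ℤ.- (+ p ℤ.- + 1) ℤ.* + b
      ≡⟨ regroup (+ R) (+ q) (+ c) (+ b) (+ p) ⟩
    (+ q ℤ.- + c) ℤ.* (+ p ℤ.* + p) ℤ.+ ((+ R ℤ.+ + c ℤ.* + p) ℤ.* + p ℤ.- (+ p ℤ.- + 1) ℤ.* + b)
      ≡⟨ cong₂ (λ x y → (+ q ℤ.- + c) ℤ.* x ℤ.+ y) (sym (ℤP.pos-* p p)) U-V≡ ⟩
    (+ q ℤ.- + c) ℤ.* + (p * p) ℤ.+ + (U ∸ V)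
      ∎
    where
    open ≡-Reasoning
    regroup : ∀ R q c b p → (R ℤ.+ q ℤ.* p) ℤ.* p ℤ.- (p ℤ.- + 1) ℤ.* b
                          ≡ (q ℤ.- c) ℤ.* (p ℤ.* p) ℤ.+ ((R ℤ.+ c ℤ.* p) ℤ.* p ℤ.- (p ℤ.- + 1) ℤ.* b)
    regroup = ℤ-Ring.solve-∀
    a≡ : + a ≡ + R ℤ.+ + q ℤ.* + p
    a≡ = trans (cong +_ (m≡m%n+[m/n]*n a p)) (trans (ℤP.pos-+ R (q * p)) (cong (λ n → + R ℤ.+ n) (ℤP.pos-* q p)))
    U≡ : + U ≡ (+ R ℤ.+ + c ℤ.* + p) ℤ.* + p
    U≡ = trans (ℤP.pos-* (R + c * p) p) (cong (ℤ._* + p) (trans (ℤP.pos-+ R (c * p)) (cong (λ n → + R ℤ.+ n) (ℤP.pos-* c p))))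
    U-V≡ : (+ R ℤ.+ + c ℤ.* + p) ℤ.* + p ℤ.- (+ p ℤ.- + 1) ℤ.* + b ≡ + (U ∸ V)
    U-V≡ = trans (cong₂ ℤ._-_ (sym U≡) (sym (ℤP.pos-* p' b))) (trans (ℤP.m-n≡m⊖n U V) (ℤP.⊖-≥ V≤U))

  summand-count : summand p d j i ≡ + c
  summand-count = begin
    ℚ.floor (+ a ℚ./ p) ℤ.- ℚ.floor (shifted p' a b)  ≡⟨ cong₂ ℤ._-_ (floor-fraction a p') shifted-floor ⟩
    + q ℤ.- (+ q ℤ.- + c)                            ≡⟨ cancel (+ q) (+ c) ⟩
    + c                                              ∎
    where
    open ≡-Reasoning
    shifted-floor : ℚ.floor (shifted p' a b) ≡ + q ℤ.- + c
    shifted-floor = floor-by-remainder (shifted p' a b) _ _ (+ q ℤ.- + c) (U ∸ V) (shifted-representation p' a b) numerator-split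
      (m<n+o⇒m∸n<o U V U<V+p²)
    cancel : ∀ x y → x ℤ.- (x ℤ.- y) ≡ y
    cancel = ℤ-Ring.solve-∀

foldr-applyUpTo : ∀ n (u f : ℕ → ℕ) (g : ℕ → ℤ) (h : ℕ → ℕ) → (∀ x → g x ≡ + h x) →
                  foldr ℤ._+_ (+ 0) (map g (map f (applyUpTo u n))) ≡ + ∑ n (λ k → h (f (u k)))
foldr-applyUpTo zero    u f g h g≗h = refl
foldr-applyUpTo (suc n) u f g h g≗h = begin
  g (f (u 0)) ℤ.+ foldr ℤ._+_ (+ 0) (map g (map f (applyUpTo (λ k → u (suc k)) n)))
    ≡⟨ cong₂ ℤ._+_ (g≗h (f (u 0))) (foldr-applyUpTo n (λ k → u (suc k)) f g h g≗h) ⟩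
  + h (f (u 0)) ℤ.+ + ∑ n (λ k → h (f (u (suc k))))
    ≡⟨ sym (ℤP.pos-+ (h (f (u 0))) _) ⟩
  + (h (f (u 0)) + ∑ n (λ k → h (f (u (suc k)))))
    ≡⟨ cong +_ (sym (∑-head n (λ k → h (f (u k))))) ⟩
  + ∑ (suc n) (λ k → h (f (u k)))
    ∎
  where open ≡-Reasoning

L-as-pairs : ∀ p' d j → L (suc p') d j ≡ + ∑ (suc p' ∸ j) (λ k → ∑ (Dilation.width p' d j) (Dilation.hit p' d (j + k)))
L-as-pairs p' d j = foldr-applyUpTo (suc p' ∸ j) (λ k → k) (λ k → j + k) (summand (suc p') d j)
                      (λ i → Residues.count p' (Dilation.width p' d j) ((i * d) % suc p')) (Summand.summand-count p' d j)

lemma2p14 : (p d j : ℕ) .{{_ : NonZero p}} → Prime p → 0 < d → ¬ (p ∣ d) → j < p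
            → L p d j ≡ L p d (p ∸ j)
lemma2p14 (suc p') d j p-prime _ p∤d j<p = begin
  L (suc p') d j                 ≡⟨ L-as-pairs p' d j ⟩
  + pairs j                      ≡⟨ cong +_ (pairs-symmetric j j<p) ⟩
  + pairs (suc p' ∸ j)           ≡⟨ sym (L-as-pairs p' d (suc p' ∸ j)) ⟩
  L (suc p') d (suc p' ∸ j)      ∎
  where
  open ≡-Reasoning
  open Dilation.Coprime p' d p-prime p∤d
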